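{- For $n\ge0$ let $$\tilde J_2(n)=\sum_{j=0}^n(-1)^j\binom{ -\frac12}{j}^{2}\binom nj=\sum_{j=0}^n(-1)^j16^{ -j}\binom{2j}{j}^{2}\binom nj.$$ Then for every odd prime $p$, $$\sum_{n=0}^{p-1}\tilde J_2(n)\equiv0\pmod{p^2}.$$
   Context: The numbers $\tilde J_2(n)$ are rationals whose denominators are powers of $2$; congruences are understood in the ring $\mathbb{Z}_{(p)}$ of rationals with denominator prime to $p$. -}

module Defs where

open import Data.Nat as ℕ using (ℕ; zero; suc)
open import Data.Nat.Combinatorics using (_C_)
open import Data.Nat using (_!)
open import Data.Nat.Properties using (_!≢0)
open import Data.Integer as ℤ using (ℤ; +_)
open import Data.Rational as ℚ using (ℚ; _+_; _*_; -_; _-_; 0ℚ; 1ℚ; _/_)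

ℕ→ℚ : ℕ → ℚ
ℕ→ℚ n = (+ n) / 1

falling : ℚ → ℕ → ℚ
falling x zero    = 1ℚ
falling x (suc j) = falling x j * (x - ℕ→ℚ j)

binomℚ : ℚ → ℕ → ℚ
binomℚ x j = falling x j * ((+ 1) / (j !))
  where instance _ = j !≢0

sign : ℕ → ℚ
sign zero    = 1ℚ
sign (suc j) = - sign j

sumTo : ℕ → (ℕ → ℚ) → ℚ
sumTo zero    f = f 0
sumTo (suc n) f = sumTo n f + f (suc n)

-½ : ℚ
-½ = ℤ.-[1+ 0 ] / 2

J̃₂ : ℕ → ℚ
J̃₂ n = sumTo n (λ j → sign j * (binomℚ -½ j * binomℚ -½ j) * ℕ→ℚ (n C j))

-- Congruence x ≡ 0 (mod m) in ℤ_(p): x = m·a/b with b a natural number not divisible by p.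
open import Data.Nat.Divisibility using (_∣_)
open import Data.Product using (∃; ∃₂; _×_)
open import Relation.Binary.PropositionalEquality using (_≡_)
open import Relation.Nullary using (¬_)

≡0mod[_in-ℤ₍_₎] : ℚ → ℕ → ℕ → Set
≡0mod[ x in-ℤ₍ m ₎] p = ∃₂ λ (a : ℤ) (b : ℕ) → (¬ (p ∣ b)) × (x * ℕ→ℚ b ≡ ℕ→ℚ m * ((a / 1)))

-- Write p = 2m + 1 and N = p - 1 = 2m. Since binom(-1/2, j) = C(2j, j) / (-4)^j, clearing denominators
-- gives 16^N J̃₂(n) = Σ_j w_j C(n, j) with integer weights w_j = (-1)^j C(2j, j)² 16^(N-j), and the
-- hockey-stick identity turns 16^N Σ_{n ≤ N} J̃₂(n) into Σ_{j ≤ N} w_j C(p, j+1) = p Σ_{j < N} w_j e_j + w_N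
-- with e_j = C(p, j+1) / p. The last weight is divisible by p² because p ∣ C(2N, N). Modulo p we have
-- (j+1) e_j = C(p-1, j) ≡ (-1)^j and C(2j, j) ≡ (-4)^j C(m, j), hence
-- (m+1) Σ_{j < N} w_j e_j ≡ 16^N Σ_j C(m, j) C(m+1, j+1) = 16^N C(p, m+1) ≡ 0 by Vandermonde,
-- and p ∣ Σ_{j < N} w_j e_j since m + 1 is a unit. Finally 16^N is prime to p.

module Submission where

open import Defs
open import Data.Nat as ℕ using (ℕ; zero; suc; _∸_; _^_; _≤_; _<_; z≤n; s≤s; _!)
import Data.Nat.Properties as ℕ
import Data.Nat.Divisibility as ℕ
import Data.Nat.DivMod as ℕ
open import Data.Nat.Combinatorics using (_C_; nCk+nC[k+1]≡[n+1]C[k+1]; k>n⇒nCk≡0; nC1≡n; nCk≡nC[n∸k]; nCn≡1)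
open import Data.Nat.Coprimality using (Coprime; prime⇒coprime; coprime-divisor)
open import Data.Nat.Primality using (Prime; euclidsLemma; ¬prime[1]; irreducible[2]; prime⇒irreducible)
open import Data.Integer as ℤ using (ℤ; +_; _+_; _*_; -_; _-_; -1ℤ)
import Data.Integer.Properties as ℤ
open import Data.Integer.Divisibility.Signed using (_∣_; divides; ∣ᵤ⇒∣; ∣⇒∣ᵤ; ∣m∣n⇒∣m+n; ∣m⇒∣-m; ∣n⇒∣m*n; ∣m⇒∣m*n)
import Data.Integer.Tactic.RingSolver as ℤ-Solver
import Data.Nat.Tactic.RingSolver as ℕ-Solver
open import Data.Rational as ℚ using (ℚ; _/_; 1ℚ)
import Data.Rational.Properties as ℚ
open import Data.Rational.Unnormalised as ℚᵘ using (mkℚᵘ; *≡*)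
import Data.Rational.Unnormalised.Properties as ℚᵘ
open import Data.Rational.Solver using (module +-*-Solver)
open import Data.Product using (∃; _,_)
open import Data.Sum using (_⊎_; inj₁; inj₂)
open import Relation.Nullary using (¬_; contradiction)
open import Relation.Binary.Bundles using (Setoid)
open import Relation.Binary.PropositionalEquality

open +-*-Solver using (solve; _:*_; _:-_; _:=_)

[k+1]*[n+1]C[k+1]≡[n+1]*nCk : ∀ n k → suc k ℕ.* (suc n C suc k) ≡ suc n ℕ.* (n C k)
[k+1]*[n+1]C[k+1]≡[n+1]*nCk zero zero = refl
[k+1]*[n+1]C[k+1]≡[n+1]*nCk zero (suc k) = ℕ.*-zeroʳ (suc (suc k))
[k+1]*[n+1]C[k+1]≡[n+1]*nCk (suc n) zero =
  trans (ℕ.+-identityʳ _) (trans (nC1≡n (suc (suc n))) (sym (ℕ.*-identityʳ _)))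
[k+1]*[n+1]C[k+1]≡[n+1]*nCk (suc n) (suc k) = begin
  suc (suc k) ℕ.* (suc (suc n) C suc (suc k))
    ≡⟨ cong (suc (suc k) ℕ.*_) (nCk+nC[k+1]≡[n+1]C[k+1] (suc n) (suc k)) ⟨
  suc (suc k) ℕ.* (a ℕ.+ b)
    ≡⟨ regroup a b k ⟩
  suc k ℕ.* a ℕ.+ suc (suc k) ℕ.* b ℕ.+ a
    ≡⟨ cong₂ (λ x y → x ℕ.+ y ℕ.+ a) ([k+1]*[n+1]C[k+1]≡[n+1]*nCk n k) ([k+1]*[n+1]C[k+1]≡[n+1]*nCk n (suc k)) ⟩
  suc n ℕ.* (n C k) ℕ.+ suc n ℕ.* (n C suc k) ℕ.+ a
    ≡⟨ cong (ℕ._+ a) (ℕ.*-distribˡ-+ (suc n) (n C k) (n C suc k)) ⟨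
  suc n ℕ.* (n C k ℕ.+ n C suc k) ℕ.+ a
    ≡⟨ cong (λ x → suc n ℕ.* x ℕ.+ a) (nCk+nC[k+1]≡[n+1]C[k+1] n k) ⟩
  suc n ℕ.* a ℕ.+ a
    ≡⟨ ℕ.+-comm (suc n ℕ.* a) a ⟩
  suc (suc n) ℕ.* a
    ∎
  where
  open ≡-Reasoning
  a b : ℕ
  a = suc n C suc k
  b = suc n C suc (suc k)
  regroup : ∀ a b k → suc (suc k) ℕ.* (a ℕ.+ b) ≡ suc k ℕ.* a ℕ.+ suc (suc k) ℕ.* b ℕ.+ a
  regroup = ℕ-Solver.solve-∀

[k+1]*nC[k+1]≡[n-k]*nCk : ∀ n k → + suc k * + (n C suc k) ≡ (+ n - + k) * + (n C k)
[k+1]*nC[k+1]≡[n-k]*nCk n k = begin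
  + suc k * b                      ≡⟨ split (+ k) a b ⟩
  + suc k * (a + b) - + suc k * a  ≡⟨ cong (_- + suc k * a) pascal-absorption ⟩
  + suc n * a - + suc k * a        ≡⟨ merge (+ n) (+ k) a ⟩
  (+ n - + k) * a                  ∎
  where
  open ≡-Reasoning
  a b : ℤ
  a = + (n C k)
  b = + (n C suc k)
  split : ∀ k a b → (+ 1 + k) * b ≡ (+ 1 + k) * (a + b) - (+ 1 + k) * a
  split = ℤ-Solver.solve-∀
  merge : ∀ n k a → (+ 1 + n) * a - (+ 1 + k) * a ≡ (n - k) * a
  merge = ℤ-Solver.solve-∀
  pascal-absorption : + suc k * (a + b) ≡ + suc n * a
  pascal-absorption = begin
    + suc k * (a + b)                    ≡⟨ cong (+ suc k *_) (ℤ.pos-+ (n C k) (n C suc k)) ⟨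
    + suc k * + (n C k ℕ.+ n C suc k)    ≡⟨ ℤ.pos-* (suc k) _ ⟨
    + (suc k ℕ.* (n C k ℕ.+ n C suc k))  ≡⟨ cong (λ x → + (suc k ℕ.* x)) (nCk+nC[k+1]≡[n+1]C[k+1] n k) ⟩
    + (suc k ℕ.* (suc n C suc k))        ≡⟨ cong +_ ([k+1]*[n+1]C[k+1]≡[n+1]*nCk n k) ⟩
    + (suc n ℕ.* (n C k))                ≡⟨ ℤ.pos-* (suc n) _ ⟩
    + suc n * a                          ∎

centralC : ℕ → ℕ
centralC n = (n ℕ.+ n) C n

[n+1]*centralC[n+1]≡2[2n+1]*centralC : ∀ n → suc n ℕ.* centralC (suc n) ≡ 2 ℕ.* suc (n ℕ.+ n) ℕ.* centralC n
[n+1]*centralC[n+1]≡2[2n+1]*centralC n = ℕ.*-cancelˡ-≡ _ _ (suc n) (begin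
  suc n ℕ.* (suc n ℕ.* centralC (suc n))         ≡⟨ cong (λ m → suc n ℕ.* (suc n ℕ.* (suc m C suc n))) (ℕ.+-suc n n) ⟩
  suc n ℕ.* (suc n ℕ.* (suc (suc 2n) C suc n))   ≡⟨ cong (suc n ℕ.*_) ([k+1]*[n+1]C[k+1]≡[n+1]*nCk (suc 2n) n) ⟩
  suc n ℕ.* (suc (suc 2n) ℕ.* (suc 2n C n))      ≡⟨ cong (λ x → suc n ℕ.* (suc (suc 2n) ℕ.* x)) symmetry ⟩
  suc n ℕ.* (suc (suc 2n) ℕ.* (suc 2n C suc n))  ≡⟨ swap (suc n) (suc (suc 2n)) (suc 2n C suc n) ⟩
  suc (suc 2n) ℕ.* (suc n ℕ.* (suc 2n C suc n))  ≡⟨ cong (suc (suc 2n) ℕ.*_) ([k+1]*[n+1]C[k+1]≡[n+1]*nCk 2n n) ⟩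
  suc (suc 2n) ℕ.* (suc 2n ℕ.* centralC n)       ≡⟨ regroup n (centralC n) ⟩
  suc n ℕ.* (2 ℕ.* suc 2n ℕ.* centralC n)        ∎)
  where
  open ≡-Reasoning
  2n : ℕ
  2n = n ℕ.+ n
  symmetry : suc 2n C n ≡ suc 2n C suc n
  symmetry = trans (nCk≡nC[n∸k] (ℕ.≤-trans (ℕ.m≤m+n n n) (ℕ.n≤1+n 2n)))
                   (cong (suc 2n C_) (ℕ.m+n∸n≡m (suc n) n))
  swap : ∀ a b c → a ℕ.* (b ℕ.* c) ≡ b ℕ.* (a ℕ.* c)
  swap = ℕ-Solver.solve-∀
  regroup : ∀ n c → suc (suc (n ℕ.+ n)) ℕ.* (suc (n ℕ.+ n) ℕ.* c) ≡ suc n ℕ.* (2 ℕ.* suc (n ℕ.+ n) ℕ.* c)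
  regroup = ℕ-Solver.solve-∀

[n+1]*centralC[n+1]≡2[2n+1]*centralCℤ : ∀ n → + suc n * + centralC (suc n) ≡ + 2 * (+ 1 + (+ n + + n)) * + centralC n
[n+1]*centralC[n+1]≡2[2n+1]*centralCℤ n = begin
  + suc n * + centralC (suc n)              ≡⟨ ℤ.pos-* (suc n) _ ⟨
  + (suc n ℕ.* centralC (suc n))            ≡⟨ cong +_ ([n+1]*centralC[n+1]≡2[2n+1]*centralC n) ⟩
  + (2 ℕ.* suc (n ℕ.+ n) ℕ.* centralC n)    ≡⟨ trans (ℤ.pos-* (2 ℕ.* suc (n ℕ.+ n)) (centralC n)) (cong (_* + centralC n) (ℤ.pos-* 2 (suc (n ℕ.+ n)))) ⟩
  + 2 * + suc (n ℕ.+ n) * + centralC n      ≡⟨ cong (λ x → + 2 * (+ 1 + x) * + centralC n) (ℤ.pos-+ n n) ⟩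
  + 2 * (+ 1 + (+ n + + n)) * + centralC n  ∎
  where open ≡-Reasoning

sum≤ : ℕ → (ℕ → ℤ) → ℤ
sum≤ zero    f = f 0
sum≤ (suc n) f = sum≤ n f + f (suc n)

sum≤-cong : ∀ n {f g : ℕ → ℤ} → (∀ j → j ≤ n → f j ≡ g j) → sum≤ n f ≡ sum≤ n g
sum≤-cong zero    f≡g = f≡g 0 z≤n
sum≤-cong (suc n) f≡g = cong₂ _+_ (sum≤-cong n (λ j j≤n → f≡g j (ℕ.m≤n⇒m≤1+n j≤n))) (f≡g (suc n) ℕ.≤-refl)

sum≤-distrib-+ : ∀ n (f g : ℕ → ℤ) → sum≤ n (λ j → f j + g j) ≡ sum≤ n f + sum≤ n g
sum≤-distrib-+ zero    f g = refl
sum≤-distrib-+ (suc n) f g = begin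
  sum≤ n (λ j → f j + g j) + (f (suc n) + g (suc n))  ≡⟨ cong (_+ (f (suc n) + g (suc n))) (sum≤-distrib-+ n f g) ⟩
  sum≤ n f + sum≤ n g + (f (suc n) + g (suc n))       ≡⟨ interchange (sum≤ n f) (sum≤ n g) (f (suc n)) (g (suc n)) ⟩
  sum≤ n f + f (suc n) + (sum≤ n g + g (suc n))       ∎
  where
  open ≡-Reasoning
  interchange : ∀ a b c d → a + b + (c + d) ≡ a + c + (b + d)
  interchange = ℤ-Solver.solve-∀

sum≤-distribˡ-* : ∀ n c (f : ℕ → ℤ) → sum≤ n (λ j → c * f j) ≡ c * sum≤ n f
sum≤-distribˡ-* zero    c f = refl
sum≤-distribˡ-* (suc n) c f =
  trans (cong (_+ c * f (suc n)) (sum≤-distribˡ-* n c f)) (sym (ℤ.*-distribˡ-+ c (sum≤ n f) (f (suc n))))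

sum≤-suc : ∀ n (f : ℕ → ℤ) → sum≤ (suc n) f ≡ f 0 + sum≤ n (λ j → f (suc j))
sum≤-suc zero    f = refl
sum≤-suc (suc n) f = trans (cong (_+ f (suc (suc n))) (sum≤-suc n f)) (ℤ.+-assoc (f 0) _ _)

sum≤-zero : ∀ n → sum≤ n (λ _ → + 0) ≡ + 0
sum≤-zero zero    = refl
sum≤-zero (suc n) = cong (_+ + 0) (sum≤-zero n)

sum≤-extend : ∀ n (f : ℕ → ℤ) → f (suc n) ≡ + 0 → sum≤ (suc n) f ≡ sum≤ n f
sum≤-extend n f f[n+1]≡0 = trans (cong (_+_ (sum≤ n f)) f[n+1]≡0) (ℤ.+-identityʳ (sum≤ n f))

pascalℤ : ∀ n k → + (n C k) + + (n C suc k) ≡ + (suc n C suc k)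
pascalℤ n k = trans (sym (ℤ.pos-+ (n C k) (n C suc k))) (cong +_ (nCk+nC[k+1]≡[n+1]C[k+1] n k))

hockey-stick : ∀ (g : ℕ → ℤ) N →
  sum≤ N (λ n → sum≤ n (λ j → g j * + (n C j))) ≡ sum≤ N (λ j → g j * + (suc N C suc j))
hockey-stick g zero    = refl
hockey-stick g (suc N) = begin
  sum≤ N (λ n → sum≤ n (λ j → g j * + (n C j))) + A  ≡⟨ cong (_+ A) (hockey-stick g N) ⟩
  sum≤ N (λ j → g j * + (suc N C suc j)) + A         ≡⟨ cong (_+ A) (sum≤-extend N _ vanishes) ⟨
  B + A                                              ≡⟨ ℤ.+-comm B A ⟩
  A + B                                              ≡⟨ sum≤-distrib-+ (suc N) _ _ ⟨
  sum≤ (suc N) (λ j → g j * + (suc N C j) + g j * + (suc N C suc j))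
    ≡⟨ sum≤-cong (suc N) (λ j _ → pascal j) ⟩
  sum≤ (suc N) (λ j → g j * + (suc (suc N) C suc j))  ∎
  where
  open ≡-Reasoning
  A B : ℤ
  A = sum≤ (suc N) (λ j → g j * + (suc N C j))
  B = sum≤ (suc N) (λ j → g j * + (suc N C suc j))
  vanishes : g (suc N) * + (suc N C suc (suc N)) ≡ + 0
  vanishes = trans (cong (λ c → g (suc N) * + c) (k>n⇒nCk≡0 (ℕ.n<1+n (suc N)))) (ℤ.*-zeroʳ (g (suc N)))
  pascal : ∀ j → g j * + (suc N C j) + g j * + (suc N C suc j) ≡ g j * + (suc (suc N) C suc j)
  pascal j = trans (sym (ℤ.*-distribˡ-+ (g j) _ _))
                   (cong (g j *_) (pascalℤ (suc N) j))

vandermonde : ∀ a b r N → a ≤ N → sum≤ N (λ j → + (a C j) * + (b C (r ℕ.+ j))) ≡ + ((a ℕ.+ b) C (a ℕ.+ r))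
vandermonde zero b r zero _ = trans (ℤ.*-identityˡ _) (cong (λ x → + (b C x)) (ℕ.+-identityʳ r))
vandermonde zero b r (suc N) _ = begin
  sum≤ (suc N) (λ j → + (0 C j) * + (b C (r ℕ.+ j)))                    ≡⟨ sum≤-suc N (λ j → + (0 C j) * + (b C (r ℕ.+ j))) ⟩
  + 1 * + (b C (r ℕ.+ 0)) + sum≤ N (λ j → + 0 * + (b C (r ℕ.+ suc j)))  ≡⟨ cong₂ _+_ (trans (ℤ.*-identityˡ _) (cong (λ x → + (b C x)) (ℕ.+-identityʳ r)))
                                                                              (trans (sum≤-cong N (λ j _ → ℤ.*-zeroˡ (+ (b C (r ℕ.+ suc j))))) (sum≤-zero N)) ⟩
  + (b C r) + + 0  ≡⟨ ℤ.+-identityʳ _ ⟩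
  + (b C r)        ∎
  where open ≡-Reasoning
vandermonde (suc a) b r (suc N) (s≤s a≤N) = begin
  sum≤ (suc N) (λ j → + (suc a C j) * + (b C (r ℕ.+ j)))  ≡⟨ sum≤-suc N (λ j → + (suc a C j) * + (b C (r ℕ.+ j))) ⟩
  first + sum≤ N (λ j → + (suc a C suc j) * + (b C (r ℕ.+ suc j)))
    ≡⟨ cong (_+_ first) (trans (sum≤-cong N (λ j _ → pascal j)) (sum≤-distrib-+ N _ _)) ⟩
  first + (X + Y)                                         ≡⟨ swap first X Y ⟩
  X + (first + Y)                                         ≡⟨ cong (_+_ X) (sum≤-suc N (λ j → + (a C j) * + (b C (r ℕ.+ j)))) ⟨
  X + sum≤ (suc N) (λ j → + (a C j) * + (b C (r ℕ.+ j)))  ≡⟨ cong₂ _+_ (vandermonde a b (suc r) N a≤N) (vandermonde a b r (suc N) (ℕ.m≤n⇒m≤1+n a≤N)) ⟩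
  + ((a ℕ.+ b) C (a ℕ.+ suc r)) + + ((a ℕ.+ b) C (a ℕ.+ r))
    ≡⟨ cong (λ x → + ((a ℕ.+ b) C x) + + ((a ℕ.+ b) C (a ℕ.+ r))) (ℕ.+-suc a r) ⟩
  + ((a ℕ.+ b) C suc (a ℕ.+ r)) + + ((a ℕ.+ b) C (a ℕ.+ r))
    ≡⟨ trans (ℤ.+-comm (+ ((a ℕ.+ b) C suc (a ℕ.+ r))) (+ ((a ℕ.+ b) C (a ℕ.+ r)))) (pascalℤ (a ℕ.+ b) (a ℕ.+ r)) ⟩
  + (suc (a ℕ.+ b) C suc (a ℕ.+ r))  ∎
  where
  open ≡-Reasoning
  first X Y : ℤ
  first = + 1 * + (b C (r ℕ.+ 0))
  X = sum≤ N (λ j → + (a C j) * + (b C (suc r ℕ.+ j)))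
  Y = sum≤ N (λ j → + (a C suc j) * + (b C (r ℕ.+ suc j)))
  swap : ∀ x y z → x + (y + z) ≡ y + (x + z)
  swap = ℤ-Solver.solve-∀
  pascal : ∀ j → + (suc a C suc j) * + (b C (r ℕ.+ suc j))
               ≡ + (a C j) * + (b C (suc r ℕ.+ j)) + + (a C suc j) * + (b C (r ℕ.+ suc j))
  pascal j rewrite ℕ.+-suc r j | sym (nCk+nC[k+1]≡[n+1]C[k+1] a j) | ℤ.pos-+ (a C j) (a C suc j) =
    ℤ.*-distribʳ-+ (+ (b C suc (r ℕ.+ j))) (+ (a C j)) (+ (a C suc j))

infix 4 _≡_mod_
record _≡_mod_ (a b : ℤ) (n : ℕ) : Set where
  constructor ≡mod
  field ∣-difference : + n ∣ a - b

module _ {n : ℕ} where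

  ≡mod-by-multiple : ∀ {a b} q → a - b ≡ q * + n → a ≡ b mod n
  ≡mod-by-multiple q eq = ≡mod (divides q eq)

  ≡mod-reflexive : ∀ {a b} → a ≡ b → a ≡ b mod n
  ≡mod-reflexive {a} refl = ≡mod-by-multiple (+ 0) (ℤ.+-inverseʳ a)

  ≡mod-sym : ∀ {a b} → a ≡ b mod n → b ≡ a mod n
  ≡mod-sym {a} {b} (≡mod d) = ≡mod (subst (+ n ∣_) (negate a b) (∣m⇒∣-m d))
    where negate : ∀ a b → - (a - b) ≡ b - a
          negate = ℤ-Solver.solve-∀

  ≡mod-trans : ∀ {a b c} → a ≡ b mod n → b ≡ c mod n → a ≡ c mod n
  ≡mod-trans {a} {b} {c} (≡mod d) (≡mod e) = ≡mod (subst (+ n ∣_) (telescope a b c) (∣m∣n⇒∣m+n d e))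
    where telescope : ∀ a b c → (a - b) + (b - c) ≡ a - c
          telescope = ℤ-Solver.solve-∀

  +-cong-mod : ∀ {a b c d} → a ≡ c mod n → b ≡ d mod n → a + b ≡ c + d mod n
  +-cong-mod {a} {b} {c} {d} (≡mod x) (≡mod y) = ≡mod (subst (+ n ∣_) (regroup a b c d) (∣m∣n⇒∣m+n x y))
    where regroup : ∀ a b c d → (a - c) + (b - d) ≡ (a + b) - (c + d)
          regroup = ℤ-Solver.solve-∀

  *-cong-mod : ∀ {a b c d} → a ≡ c mod n → b ≡ d mod n → a * b ≡ c * d mod n
  *-cong-mod {a} {b} {c} {d} (≡mod x) (≡mod y) =
    ≡mod (subst (+ n ∣_) (regroup a b c d) (∣m∣n⇒∣m+n (∣n⇒∣m*n a y) (∣m⇒∣m*n d x)))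
    where regroup : ∀ a b c d → a * (b - d) + (a - c) * d ≡ a * b - c * d
          regroup = ℤ-Solver.solve-∀

  -‿cong-mod : ∀ {a b} → a ≡ b mod n → - a ≡ - b mod n
  -‿cong-mod {a} {b} (≡mod d) = ≡mod (subst (+ n ∣_) (negate a b) (∣m⇒∣-m d))
    where negate : ∀ a b → - (a - b) ≡ - a - - b
          negate = ℤ-Solver.solve-∀

  *-congˡ-mod : ∀ c {a b} → a ≡ b mod n → c * a ≡ c * b mod n
  *-congˡ-mod c = *-cong-mod (≡mod-reflexive {c} refl)

  *-congʳ-mod : ∀ c {a b} → a ≡ b mod n → a * c ≡ b * c mod n
  *-congʳ-mod c a≡b = *-cong-mod a≡b (≡mod-reflexive {c} refl)

  ≡0-mod⇒∣ : ∀ {a} → a ≡ + 0 mod n → + n ∣ a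
  ≡0-mod⇒∣ {a} (≡mod d) = subst (+ n ∣_) (ℤ.+-identityʳ a) d

  ∣⇒≡0-mod : ∀ {a} → + n ∣ a → a ≡ + 0 mod n
  ∣⇒≡0-mod {a} d = ≡mod (subst (+ n ∣_) (sym (ℤ.+-identityʳ a)) d)

≡mod-setoid : ℕ → Setoid _ _
≡mod-setoid n = record
  { Carrier       = ℤ
  ; _≈_           = λ a b → a ≡ b mod n
  ; isEquivalence = record { refl = ≡mod-reflexive refl ; sym = ≡mod-sym ; trans = ≡mod-trans }
  }

sum≤-cong-mod : ∀ {m} N {f g : ℕ → ℤ} → (∀ j → j ≤ N → f j ≡ g j mod m) → sum≤ N f ≡ sum≤ N g mod m
sum≤-cong-mod zero    f≡g = f≡g 0 z≤n
sum≤-cong-mod (suc N) f≡g =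
  +-cong-mod (sum≤-cong-mod N (λ j j≤N → f≡g j (ℕ.m≤n⇒m≤1+n j≤N))) (f≡g (suc N) ℕ.≤-refl)

module _ {p : ℕ} (p-prime : Prime p) {k : ℕ} (0<k : 0 < k) (k<p : k < p) where

  private
    p⊥k : Coprime p k
    p⊥k = prime⇒coprime p-prime {{ℕ.>-nonZero 0<k}} k<p

  prime∣k*n⇒prime∣n : ∀ {n} → p ℕ.∣ k ℕ.* n → p ℕ.∣ n
  prime∣k*n⇒prime∣n = coprime-divisor p⊥k

  *-cancelˡ-≡mod : ∀ {a b} → + k * a ≡ + k * b mod p → a ≡ b mod p
  *-cancelˡ-≡mod {a} {b} (≡mod d) = ≡mod (∣ᵤ⇒∣ (coprime-divisor p⊥k (subst (p ℕ.∣_) ∣k[a-b]∣≡k∣a-b∣ (∣⇒∣ᵤ d))))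
    where
    ∣k[a-b]∣≡k∣a-b∣ : ℤ.∣ + k * a - + k * b ∣ ≡ k ℕ.* ℤ.∣ a - b ∣
    ∣k[a-b]∣≡k∣a-b∣ = trans (cong ℤ.∣_∣ (factor (+ k) a b)) (ℤ.abs-* (+ k) (a - b))
      where factor : ∀ k a b → k * a - k * b ≡ k * (a - b)
            factor = ℤ-Solver.solve-∀

-- Binomial coefficients modulo an odd prime p = 2m + 1

prime∣pCk : ∀ {p k} → Prime p → 0 < k → k < p → p ℕ.∣ p C k
prime∣pCk {suc p-1} {suc k} p-prime 0<k k<p = prime∣k*n⇒prime∣n p-prime 0<k k<p
  (ℕ.divides (p-1 C k) (trans ([k+1]*[n+1]C[k+1]≡[n+1]*nCk p-1 k) (ℕ.*-comm (suc p-1) (p-1 C k))))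

nCk≡[-1]^k : ∀ {n k} → Prime (suc n) → k ≤ n → + (n C k) ≡ -1ℤ ℤ.^ k mod suc n
nCk≡[-1]^k {n} {zero}  p-prime _   = ≡mod-reflexive refl
nCk≡[-1]^k {n} {suc k} p-prime k<n = begin
  + (n C suc k)                          ≡⟨ isolate (+ (n C k)) (+ (n C suc k)) ⟩
  + (n C k) + + (n C suc k) - + (n C k)  ≡⟨ cong (_- + (n C k)) (pascalℤ n k) ⟩
  + (suc n C suc k) - + (n C k)          ≈⟨ +-cong-mod (∣⇒≡0-mod {a = + (suc n C suc k)} (∣ᵤ⇒∣ (prime∣pCk p-prime (s≤s z≤n) (s≤s k<n))))
                                                       (-‿cong-mod (nCk≡[-1]^k p-prime (ℕ.<⇒≤ k<n))) ⟩
  + 0 - -1ℤ ℤ.^ k  ≡⟨ trans (ℤ.+-identityˡ _) (sym (ℤ.-1*i≡-i (-1ℤ ℤ.^ k))) ⟩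
  -1ℤ ℤ.^ suc k    ∎
  where
  open import Relation.Binary.Reasoning.Setoid (≡mod-setoid (suc n))
  isolate : ∀ a b → b ≡ a + b - a
  isolate = ℤ-Solver.solve-∀

2[2k+1]≡-4[m-k] : ∀ m k → + 2 * (+ 1 + (+ k + + k)) ≡ - + 4 * (+ m - + k) mod suc (m ℕ.+ m)
2[2k+1]≡-4[m-k] m k = ≡mod-by-multiple (+ 2) (begin
  + 2 * (+ 1 + (+ k + + k)) - - + 4 * (+ m - + k)  ≡⟨ difference (+ k) (+ m) ⟩
  + 2 * (+ 1 + (+ m + + m))                        ≡⟨ cong (λ x → + 2 * (+ 1 + x)) (ℤ.pos-+ m m) ⟨
  + 2 * + suc (m ℕ.+ m)                            ∎)
  where
  open ≡-Reasoning
  difference : ∀ k m → + 2 * (+ 1 + (k + k)) - - + 4 * (m - k) ≡ + 2 * (+ 1 + (m + m))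
  difference = ℤ-Solver.solve-∀

centralC≡[-4]^k*mCk : ∀ {m k} → Prime (suc (m ℕ.+ m)) → k ≤ m ℕ.+ m →
                      + centralC k ≡ (- + 4) ℤ.^ k * + (m C k) mod suc (m ℕ.+ m)
centralC≡[-4]^k*mCk {m} {zero}  _       _    = ≡mod-reflexive refl
centralC≡[-4]^k*mCk {m} {suc k} p-prime k<2m = *-cancelˡ-≡mod p-prime (s≤s z≤n) (s≤s k<2m) (begin
  + suc k * + centralC (suc k)              ≡⟨ [n+1]*centralC[n+1]≡2[2n+1]*centralCℤ k ⟩
  + 2 * (+ 1 + (+ k + + k)) * + centralC k  ≈⟨ *-congˡ-mod (+ 2 * (+ 1 + (+ k + + k)))
                                                               (centralC≡[-4]^k*mCk p-prime (ℕ.<⇒≤ k<2m)) ⟩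
  + 2 * (+ 1 + (+ k + + k)) * ((- + 4) ℤ.^ k * + (m C k))  ≈⟨ *-congʳ-mod ((- + 4) ℤ.^ k * + (m C k)) (2[2k+1]≡-4[m-k] m k) ⟩
  - + 4 * (+ m - + k) * ((- + 4) ℤ.^ k * + (m C k))        ≡⟨ interchange (- + 4) ((- + 4) ℤ.^ k) (+ m - + k) (+ (m C k)) ⟩
  (- + 4) ℤ.^ suc k * ((+ m - + k) * + (m C k))            ≡⟨ cong ((- + 4) ℤ.^ suc k *_) ([k+1]*nC[k+1]≡[n-k]*nCk m k) ⟨
  (- + 4) ℤ.^ suc k * (+ suc k * + (m C suc k))            ≡⟨ swap ((- + 4) ℤ.^ suc k) (+ suc k) (+ (m C suc k)) ⟩
  + suc k * ((- + 4) ℤ.^ suc k * + (m C suc k))            ∎)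
  where
  open import Relation.Binary.Reasoning.Setoid (≡mod-setoid (suc (m ℕ.+ m)))
  interchange : ∀ c x a d → c * a * (x * d) ≡ c * x * (a * d)
  interchange = ℤ-Solver.solve-∀
  swap : ∀ a b c → a * (b * c) ≡ b * (a * c)
  swap = ℤ-Solver.solve-∀

prime∣centralC : ∀ {m k} → Prime (suc (m ℕ.+ m)) → m < k → k ≤ m ℕ.+ m → suc (m ℕ.+ m) ℕ.∣ centralC k
prime∣centralC {m} {k} p-prime m<k k≤2m = ∣⇒∣ᵤ (≡0-mod⇒∣ (begin
  + centralC k               ≈⟨ centralC≡[-4]^k*mCk p-prime k≤2m ⟩
  (- + 4) ℤ.^ k * + (m C k)  ≡⟨ cong (λ c → (- + 4) ℤ.^ k * + c) (k>n⇒nCk≡0 m<k) ⟩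
  (- + 4) ℤ.^ k * + 0        ≡⟨ ℤ.*-zeroʳ ((- + 4) ℤ.^ k) ⟩
  + 0                        ∎))
  where open import Relation.Binary.Reasoning.Setoid (≡mod-setoid (suc (m ℕ.+ m)))

-- The scaled sum 16^N Σ_{n ≤ N} J̃₂(n) is an integer divisible by p²

^-square : ∀ i n → i ℤ.^ n * i ℤ.^ n ≡ (i * i) ℤ.^ n
^-square i zero    = refl
^-square i (suc n) = trans (interchange i (i ℤ.^ n)) (cong (i * i *_) (^-square i n))
  where interchange : ∀ i x → i * x * (i * x) ≡ i * i * (x * x)
        interchange = ℤ-Solver.solve-∀

[-1]^n*[-1]^n≡1 : ∀ n → -1ℤ ℤ.^ n * -1ℤ ℤ.^ n ≡ + 1
[-1]^n*[-1]^n≡1 n = trans (^-square -1ℤ n) (ℤ.^-zeroˡ n)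

[-4]^j*[-4]^j*16^[n∸j]≡16^n : ∀ {j n} → j ≤ n → (- + 4) ℤ.^ j * (- + 4) ℤ.^ j * (+ 16) ℤ.^ (n ∸ j) ≡ (+ 16) ℤ.^ n
[-4]^j*[-4]^j*16^[n∸j]≡16^n {j} {n} j≤n = begin
  (- + 4) ℤ.^ j * (- + 4) ℤ.^ j * (+ 16) ℤ.^ (n ∸ j)  ≡⟨ cong (_* (+ 16) ℤ.^ (n ∸ j)) (^-square (- + 4) j) ⟩
  (+ 16) ℤ.^ j * (+ 16) ℤ.^ (n ∸ j)                   ≡⟨ ℤ.^-distribˡ-+-* (+ 16) j (n ∸ j) ⟨
  (+ 16) ℤ.^ (j ℕ.+ (n ∸ j))                          ≡⟨ cong ((+ 16) ℤ.^_) (ℕ.m+[n∸m]≡n j≤n) ⟩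
  (+ 16) ℤ.^ n                                        ∎
  where open ≡-Reasoning

pos-^ : ∀ a n → + (a ^ n) ≡ (+ a) ℤ.^ n
pos-^ a zero    = refl
pos-^ a (suc n) = trans (ℤ.pos-* a (a ^ n)) (cong (+ a *_) (pos-^ a n))

weight : ℕ → ℕ → ℤ
weight n j = -1ℤ ℤ.^ j * (+ centralC j * + centralC j) * (+ 16) ℤ.^ (n ∸ j)

scaledSumJ̃₂ : ℕ → ℤ
scaledSumJ̃₂ N = sum≤ N (λ n → sum≤ n (λ j → weight N j * + (n C j)))

n∣a⇒n*n∣n*a : ∀ {n a} → + n ∣ a → + (n ℕ.* n) ∣ + n * a
n∣a⇒n*n∣n*a {n} (divides q refl) = divides q (begin
  + n * (q * + n)  ≡⟨ regroup (+ n) q ⟩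
  q * (+ n * + n)  ≡⟨ cong (q *_) (ℤ.pos-* n n) ⟨
  q * + (n ℕ.* n)  ∎)
  where
  open ≡-Reasoning
  regroup : ∀ n q → n * (q * n) ≡ q * (n * n)
  regroup = ℤ-Solver.solve-∀

-- m is written as suc m-1 so that N = m + m reduces to suc N-1.
module _ (m-1 : ℕ) (p-prime : Prime (suc (suc m-1 ℕ.+ suc m-1))) where

  private
    m N-1 N p : ℕ
    m   = suc m-1
    N-1 = m-1 ℕ.+ m
    N   = m ℕ.+ m
    p   = suc N

    j<p : ∀ {j} → j ≤ N-1 → suc j < p
    j<p j≤N-1 = s≤s (s≤s j≤N-1)

    -- an exact division, as p ∣ C(p, j+1) for j + 1 < p
    quotient : ℕ → ℕ
    quotient j = (p C suc j) ℕ./ p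

    pC[j+1]≡quotient*p : ∀ {j} → j ≤ N-1 → p C suc j ≡ quotient j ℕ.* p
    pC[j+1]≡quotient*p j≤N-1 = sym (ℕ.m/n*n≡m (prime∣pCk p-prime (s≤s z≤n) (j<p j≤N-1)))

    [j+1]*quotient≡NCj : ∀ {j} → j ≤ N-1 → suc j ℕ.* quotient j ≡ N C j
    [j+1]*quotient≡NCj {j} j≤N-1 = ℕ.*-cancelʳ-≡ _ _ p (begin
      suc j ℕ.* quotient j ℕ.* p    ≡⟨ ℕ.*-assoc (suc j) (quotient j) p ⟩
      suc j ℕ.* (quotient j ℕ.* p)  ≡⟨ cong (suc j ℕ.*_) (pC[j+1]≡quotient*p j≤N-1) ⟨
      suc j ℕ.* (p C suc j)         ≡⟨ [k+1]*[n+1]C[k+1]≡[n+1]*nCk N j ⟩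
      p ℕ.* (N C j)                 ≡⟨ ℕ.*-comm p (N C j) ⟩
      (N C j) ℕ.* p                 ∎)
      where open ≡-Reasoning

    [m+1]*weight*quotient≡16^N*mCj*[m+1]C[j+1] : ∀ j → j ≤ N-1 →
      + suc m * (weight N j * + quotient j) ≡ (+ 16) ℤ.^ N * (+ (m C j) * + (suc m C suc j)) mod p
    [m+1]*weight*quotient≡16^N*mCj*[m+1]C[j+1] j j≤N-1 = begin
      + suc m * (s * (c * c) * F * E)              ≈⟨ *-congˡ-mod (+ suc m) (*-congʳ-mod E (*-congʳ-mod F (*-congˡ-mod s (*-cong-mod c≡ c≡)))) ⟩
      + suc m * (s * ((Q * A) * (Q * A)) * F * E)  ≡⟨ regroup₁ (+ suc m) s Q A F E ⟩
      s * (Q * Q * F) * A * ((+ suc m * A) * E)    ≡⟨ cong₂ (λ x y → s * x * A * (y * E)) ([-4]^j*[-4]^j*16^[n∸j]≡16^n j≤N) absorption ⟩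
      s * (+ 16) ℤ.^ N * A * ((+ suc j * B) * E)   ≡⟨ regroup₂ s ((+ 16) ℤ.^ N) A (+ suc j) B E ⟩
      s * (+ 16) ℤ.^ N * A * B * (+ suc j * E)     ≡⟨ cong (s * (+ 16) ℤ.^ N * A * B *_) (trans (sym (ℤ.pos-* (suc j) (quotient j))) (cong +_ ([j+1]*quotient≡NCj j≤N-1))) ⟩
      s * (+ 16) ℤ.^ N * A * B * + (N C j)         ≈⟨ *-congˡ-mod (s * (+ 16) ℤ.^ N * A * B) (nCk≡[-1]^k p-prime j≤N) ⟩
      s * (+ 16) ℤ.^ N * A * B * s                 ≡⟨ regroup₃ s ((+ 16) ℤ.^ N) A B ⟩
      s * s * ((+ 16) ℤ.^ N * (A * B))             ≡⟨ trans (cong (_* ((+ 16) ℤ.^ N * (A * B))) ([-1]^n*[-1]^n≡1 j)) (ℤ.*-identityˡ _) ⟩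
      (+ 16) ℤ.^ N * (A * B)                       ∎
      where
      open import Relation.Binary.Reasoning.Setoid (≡mod-setoid p)
      s c F E Q A B : ℤ
      s = -1ℤ ℤ.^ j
      c = + centralC j
      F = (+ 16) ℤ.^ (N ∸ j)
      E = + quotient j
      Q = (- + 4) ℤ.^ j
      A = + (m C j)
      B = + (suc m C suc j)
      j≤N : j ≤ N
      j≤N = ℕ.m≤n⇒m≤1+n j≤N-1
      c≡ : c ≡ Q * A mod p
      c≡ = centralC≡[-4]^k*mCk p-prime j≤N
      absorption : + suc m * A ≡ + suc j * B
      absorption = trans (sym (ℤ.pos-* (suc m) (m C j)))
                         (trans (cong +_ (sym ([k+1]*[n+1]C[k+1]≡[n+1]*nCk m j))) (ℤ.pos-* (suc j) (suc m C suc j)))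
      regroup₁ : ∀ a s Q A F E → a * (s * ((Q * A) * (Q * A)) * F * E) ≡ s * (Q * Q * F) * A * ((a * A) * E)
      regroup₁ = ℤ-Solver.solve-∀
      regroup₂ : ∀ s F A a B E → s * F * A * ((a * B) * E) ≡ s * F * A * B * (a * E)
      regroup₂ = ℤ-Solver.solve-∀
      regroup₃ : ∀ s F A B → s * F * A * B * s ≡ s * s * (F * (A * B))
      regroup₃ = ℤ-Solver.solve-∀

    W : ℤ
    W = sum≤ N-1 (λ j → weight N j * + quotient j)

    p∣W : + p ∣ W
    p∣W = ≡0-mod⇒∣ (*-cancelˡ-≡mod p-prime (s≤s z≤n) m+1<p (begin
      + suc m * W                                                      ≡⟨ sum≤-distribˡ-* N-1 (+ suc m) _ ⟨
      sum≤ N-1 (λ j → + suc m * (weight N j * + quotient j))           ≈⟨ sum≤-cong-mod N-1 [m+1]*weight*quotient≡16^N*mCj*[m+1]C[j+1] ⟩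
      sum≤ N-1 (λ j → (+ 16) ℤ.^ N * (+ (m C j) * + (suc m C suc j)))  ≡⟨ sum≤-distribˡ-* N-1 ((+ 16) ℤ.^ N) _ ⟩
      (+ 16) ℤ.^ N * sum≤ N-1 (λ j → + (m C j) * + (suc m C suc j))    ≡⟨ cong ((+ 16) ℤ.^ N *_) (vandermonde m (suc m) 1 N-1 (ℕ.m≤n+m m m-1)) ⟩
      (+ 16) ℤ.^ N * + ((m ℕ.+ suc m) C (m ℕ.+ 1))                     ≈⟨ *-congˡ-mod ((+ 16) ℤ.^ N) (∣⇒≡0-mod (∣ᵤ⇒∣ p∣pC[m+1])) ⟩
      (+ 16) ℤ.^ N * + 0                                               ≡⟨ ℤ.*-zeroʳ ((+ 16) ℤ.^ N) ⟩
      + 0                                                              ≡⟨ ℤ.*-zeroʳ (+ suc m) ⟨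
      + suc m * + 0                                                    ∎))
      where
      open import Relation.Binary.Reasoning.Setoid (≡mod-setoid p)
      m+1<p : suc m < p
      m+1<p = s≤s (s≤s (ℕ.m≤n+m m m-1))
      p∣pC[m+1] : p ℕ.∣ (m ℕ.+ suc m) C (m ℕ.+ 1)
      p∣pC[m+1] = subst₂ (λ n k → p ℕ.∣ n C k) (sym (ℕ.+-suc m m)) (ℕ.+-comm 1 m) (prime∣pCk p-prime (s≤s z≤n) m+1<p)

    p²∣weight[N,N] : + (p ℕ.* p) ∣ weight N N
    p²∣weight[N,N] = ∣m⇒∣m*n ((+ 16) ℤ.^ (N ∸ N)) (∣n⇒∣m*n (-1ℤ ℤ.^ N) (subst (+ (p ℕ.* p) ∣_) (ℤ.pos-* c c) (∣ᵤ⇒∣ (ℕ.*-pres-∣ p∣c p∣c))))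
      where
      c : ℕ
      c = centralC N
      p∣c : p ℕ.∣ c
      p∣c = prime∣centralC p-prime (ℕ.m<n+m m (s≤s z≤n)) ℕ.≤-refl

    scaledSumJ̃₂≡p*W+weight[N,N] : scaledSumJ̃₂ N ≡ + p * W + weight N N
    scaledSumJ̃₂≡p*W+weight[N,N] = begin
      scaledSumJ̃₂ N                                                         ≡⟨ hockey-stick (weight N) N ⟩
      sum≤ N-1 (λ j → weight N j * + (p C suc j)) + weight N N * + (p C p)   ≡⟨ cong₂ _+_ (sum≤-cong N-1 factor-p) (cong (λ c → weight N N * + c) (nCn≡1 p)) ⟩
      sum≤ N-1 (λ j → + p * (weight N j * + quotient j)) + weight N N * + 1  ≡⟨ cong₂ _+_ (sum≤-distribˡ-* N-1 (+ p) _) (ℤ.*-identityʳ (weight N N)) ⟩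
      + p * W + weight N N                                                   ∎
      where
      open ≡-Reasoning
      factor-p : ∀ j → j ≤ N-1 → weight N j * + (p C suc j) ≡ + p * (weight N j * + quotient j)
      factor-p j j≤N-1 = begin
        weight N j * + (p C suc j)         ≡⟨ cong (λ c → weight N j * + c) (pC[j+1]≡quotient*p j≤N-1) ⟩
        weight N j * + (quotient j ℕ.* p)  ≡⟨ cong (weight N j *_) (ℤ.pos-* (quotient j) p) ⟩
        weight N j * (+ quotient j * + p)  ≡⟨ regroup (weight N j) (+ quotient j) (+ p) ⟩
        + p * (weight N j * + quotient j)  ∎
        where
        regroup : ∀ w e p → w * (e * p) ≡ p * (w * e)
        regroup = ℤ-Solver.solve-∀

  p²∣scaledSumJ̃₂ : + (p ℕ.* p) ∣ scaledSumJ̃₂ N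
  p²∣scaledSumJ̃₂ = subst (+ (p ℕ.* p) ∣_) (sym scaledSumJ̃₂≡p*W+weight[N,N]) (∣m∣n⇒∣m+n (n∣a⇒n*n∣n*a p∣W) p²∣weight[N,N])

-- Clearing denominators

-- ℕ→ℚ n is definitionally ℤ→ℚ (+ n).
ℤ→ℚ : ℤ → ℚ
ℤ→ℚ i = i / 1

private
  toℚᵘ-ℤ→ℚ : ∀ i → ℚ.toℚᵘ (ℤ→ℚ i) ℚᵘ.≃ mkℚᵘ i 0
  toℚᵘ-ℤ→ℚ i = ℚ.toℚᵘ-fromℚᵘ (mkℚᵘ i 0)

ℤ→ℚ-homo-+ : ∀ a b → ℤ→ℚ (a + b) ≡ ℤ→ℚ a ℚ.+ ℤ→ℚ b
ℤ→ℚ-homo-+ a b = ℚ.toℚᵘ-injective (begin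
  ℚ.toℚᵘ (ℤ→ℚ (a + b))                ≈⟨ toℚᵘ-ℤ→ℚ (a + b) ⟩
  mkℚᵘ (a + b) 0                      ≈⟨ *≡* (normalise a b) ⟩
  mkℚᵘ a 0 ℚᵘ.+ mkℚᵘ b 0              ≈⟨ ℚᵘ.+-cong (toℚᵘ-ℤ→ℚ a) (toℚᵘ-ℤ→ℚ b) ⟨
  ℚ.toℚᵘ (ℤ→ℚ a) ℚᵘ.+ ℚ.toℚᵘ (ℤ→ℚ b)  ≈⟨ ℚ.toℚᵘ-homo-+ (ℤ→ℚ a) (ℤ→ℚ b) ⟨
  ℚ.toℚᵘ (ℤ→ℚ a ℚ.+ ℤ→ℚ b)            ∎)
  where
  open ℚᵘ.≃-Reasoning
  normalise : ∀ a b → (a + b) * (+ 1 * + 1) ≡ (a * + 1 + b * + 1) * + 1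
  normalise = ℤ-Solver.solve-∀

ℤ→ℚ-homo-* : ∀ a b → ℤ→ℚ (a * b) ≡ ℤ→ℚ a ℚ.* ℤ→ℚ b
ℤ→ℚ-homo-* a b = ℚ.toℚᵘ-injective (begin
  ℚ.toℚᵘ (ℤ→ℚ (a * b))                ≈⟨ toℚᵘ-ℤ→ℚ (a * b) ⟩
  mkℚᵘ (a * b) 0                      ≈⟨ *≡* (normalise a b) ⟩
  mkℚᵘ a 0 ℚᵘ.* mkℚᵘ b 0              ≈⟨ ℚᵘ.*-cong (toℚᵘ-ℤ→ℚ a) (toℚᵘ-ℤ→ℚ b) ⟨
  ℚ.toℚᵘ (ℤ→ℚ a) ℚᵘ.* ℚ.toℚᵘ (ℤ→ℚ b)  ≈⟨ ℚ.toℚᵘ-homo-* (ℤ→ℚ a) (ℤ→ℚ b) ⟨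
  ℚ.toℚᵘ (ℤ→ℚ a ℚ.* ℤ→ℚ b)            ∎)
  where
  open ℚᵘ.≃-Reasoning
  normalise : ∀ a b → (a * b) * (+ 1 * + 1) ≡ (a * b) * + 1
  normalise = ℤ-Solver.solve-∀

ℤ→ℚ-homo‿- : ∀ a → ℤ→ℚ (- a) ≡ ℚ.- ℤ→ℚ a
ℤ→ℚ-homo‿- a = ℚ.toℚᵘ-injective (begin
  ℚ.toℚᵘ (ℤ→ℚ (- a))   ≈⟨ toℚᵘ-ℤ→ℚ (- a) ⟩
  ℚᵘ.- mkℚᵘ a 0        ≈⟨ ℚᵘ.-‿cong (toℚᵘ-ℤ→ℚ a) ⟨
  ℚᵘ.- ℚ.toℚᵘ (ℤ→ℚ a)  ≈⟨ ℚ.toℚᵘ-homo‿- (ℤ→ℚ a) ⟨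
  ℚ.toℚᵘ (ℚ.- ℤ→ℚ a)   ∎)
  where open ℚᵘ.≃-Reasoning

1/n*n≡1 : ∀ n .{{_ : ℕ.NonZero n}} → (+ 1 / n) ℚ.* ℕ→ℚ n ≡ 1ℚ
1/n*n≡1 (suc n-1) = ℚ.toℚᵘ-injective (begin
  ℚ.toℚᵘ ((+ 1 / suc n-1) ℚ.* ℤ→ℚ (+ suc n-1))          ≈⟨ ℚ.toℚᵘ-homo-* (+ 1 / suc n-1) (ℤ→ℚ (+ suc n-1)) ⟩
  ℚ.toℚᵘ (+ 1 / suc n-1) ℚᵘ.* ℚ.toℚᵘ (ℤ→ℚ (+ suc n-1))  ≈⟨ ℚᵘ.*-cong (ℚ.toℚᵘ-fromℚᵘ (mkℚᵘ (+ 1) n-1)) (toℚᵘ-ℤ→ℚ (+ suc n-1)) ⟩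
  mkℚᵘ (+ 1) n-1 ℚᵘ.* mkℚᵘ (+ suc n-1) 0                ≈⟨ *≡* (trans (reassoc (+ suc n-1)) (cong (+ 1 *_) (sym (ℤ.pos-* (suc n-1) 1)))) ⟩
  ℚᵘ.1ℚᵘ                                                ∎)
  where
  open ℚᵘ.≃-Reasoning
  reassoc : ∀ x → + 1 * x * + 1 ≡ + 1 * (x * + 1)
  reassoc = ℤ-Solver.solve-∀

sign≡[-1]^j : ∀ j → sign j ≡ ℤ→ℚ (-1ℤ ℤ.^ j)
sign≡[-1]^j zero    = refl
sign≡[-1]^j (suc j) = trans (cong ℚ.-_ (sign≡[-1]^j j))
                             (trans (sym (ℤ→ℚ-homo‿- (-1ℤ ℤ.^ j))) (cong ℤ→ℚ (sym (ℤ.-1*i≡-i (-1ℤ ℤ.^ j)))))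

[-½-j]*[-4]≡2[2j+1] : ∀ j → (-½ ℚ.- ℕ→ℚ j) ℚ.* ℤ→ℚ (- + 4) ≡ ℤ→ℚ (+ 2 * (+ 1 + (+ j + + j)))
[-½-j]*[-4]≡2[2j+1] j = begin
  (-½ ℚ.- ℕ→ℚ j) ℚ.* ℤ→ℚ (- + 4)                ≡⟨ distrib -½ (ℕ→ℚ j) (ℤ→ℚ (- + 4)) ⟩
  -½ ℚ.* ℤ→ℚ (- + 4) ℚ.- ℕ→ℚ j ℚ.* ℤ→ℚ (- + 4)  ≡⟨ cong (ℚ._-_ (ℤ→ℚ (+ 2))) (ℤ→ℚ-homo-* (+ j) (- + 4)) ⟨
  ℤ→ℚ (+ 2) ℚ.- ℤ→ℚ (+ j * - + 4)               ≡⟨ cong (ℚ._+_ (ℤ→ℚ (+ 2))) (ℤ→ℚ-homo‿- (+ j * - + 4)) ⟨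
  ℤ→ℚ (+ 2) ℚ.+ ℤ→ℚ (- (+ j * - + 4))           ≡⟨ ℤ→ℚ-homo-+ (+ 2) (- (+ j * - + 4)) ⟨
  ℤ→ℚ (+ 2 - + j * - + 4)                       ≡⟨ cong ℤ→ℚ (expand (+ j)) ⟩
  ℤ→ℚ (+ 2 * (+ 1 + (+ j + + j)))               ∎
  where
  open ≡-Reasoning
  distrib : ∀ a x t → (a ℚ.- x) ℚ.* t ≡ a ℚ.* t ℚ.- x ℚ.* t
  distrib = solve 3 (λ a x t → (a :- x) :* t := a :* t :- x :* t) refl
  expand : ∀ j → + 2 - j * - + 4 ≡ + 2 * (+ 1 + (j + j))
  expand = ℤ-Solver.solve-∀

falling[-½]*[-4]^j≡centralC*j! : ∀ j → falling -½ j ℚ.* ℤ→ℚ ((- + 4) ℤ.^ j) ≡ ℤ→ℚ (+ centralC j * + (j !))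
falling[-½]*[-4]^j≡centralC*j! zero    = refl
falling[-½]*[-4]^j≡centralC*j! (suc j) = begin
  falling -½ j ℚ.* (-½ ℚ.- ℕ→ℚ j) ℚ.* ℤ→ℚ (- + 4 * Q)               ≡⟨ cong (falling -½ j ℚ.* (-½ ℚ.- ℕ→ℚ j) ℚ.*_) (ℤ→ℚ-homo-* (- + 4) Q) ⟩
  falling -½ j ℚ.* (-½ ℚ.- ℕ→ℚ j) ℚ.* (ℤ→ℚ (- + 4) ℚ.* ℤ→ℚ Q)       ≡⟨ regroup (falling -½ j) (-½ ℚ.- ℕ→ℚ j) (ℤ→ℚ (- + 4)) (ℤ→ℚ Q) ⟩
  falling -½ j ℚ.* ℤ→ℚ Q ℚ.* ((-½ ℚ.- ℕ→ℚ j) ℚ.* ℤ→ℚ (- + 4))       ≡⟨ cong₂ ℚ._*_ (falling[-½]*[-4]^j≡centralC*j! j) ([-½-j]*[-4]≡2[2j+1] j) ⟩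
  ℤ→ℚ (+ centralC j * + (j !)) ℚ.* ℤ→ℚ (+ 2 * (+ 1 + (+ j + + j)))  ≡⟨ ℤ→ℚ-homo-* (+ centralC j * + (j !)) (+ 2 * (+ 1 + (+ j + + j))) ⟨
  ℤ→ℚ (+ centralC j * + (j !) * (+ 2 * (+ 1 + (+ j + + j))))        ≡⟨ cong ℤ→ℚ recurrence ⟩
  ℤ→ℚ (+ centralC (suc j) * + (suc j !))                            ∎
  where
  open ≡-Reasoning
  Q : ℤ
  Q = (- + 4) ℤ.^ j
  regroup : ∀ f a c q → f ℚ.* a ℚ.* (c ℚ.* q) ≡ f ℚ.* q ℚ.* (a ℚ.* c)
  regroup = solve 4 (λ f a c q → f :* a :* (c :* q) := f :* q :* (a :* c)) refl
  recurrence : + centralC j * + (j !) * (+ 2 * (+ 1 + (+ j + + j))) ≡ + centralC (suc j) * + (suc j !)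
  recurrence = begin
    + centralC j * + (j !) * t  ≡⟨ rotate (+ centralC j) (+ (j !)) t ⟩
    t * + centralC j * + (j !)  ≡⟨ cong (_* + (j !)) ([n+1]*centralC[n+1]≡2[2n+1]*centralCℤ j) ⟨
    + suc j * + centralC (suc j) * + (j !) ≡⟨ rotate′ (+ suc j) (+ centralC (suc j)) (+ (j !)) ⟩
    + centralC (suc j) * (+ suc j * + (j !)) ≡⟨ cong (+ centralC (suc j) *_) (ℤ.pos-* (suc j) (j !)) ⟨
    + centralC (suc j) * + (suc j !)  ∎
    where
    t : ℤ
    t = + 2 * (+ 1 + (+ j + + j))
    rotate : ∀ c f t → c * f * t ≡ t * c * f
    rotate = ℤ-Solver.solve-∀
    rotate′ : ∀ s c f → s * c * f ≡ c * (s * f)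
    rotate′ = ℤ-Solver.solve-∀

binom[-½]*[-4]^j≡centralC : ∀ j → binomℚ -½ j ℚ.* ℤ→ℚ ((- + 4) ℤ.^ j) ≡ ℤ→ℚ (+ centralC j)
binom[-½]*[-4]^j≡centralC j = begin
  falling -½ j ℚ.* u ℚ.* ℤ→ℚ Q              ≡⟨ regroup (falling -½ j) u (ℤ→ℚ Q) ⟩
  falling -½ j ℚ.* ℤ→ℚ Q ℚ.* u              ≡⟨ cong (ℚ._* u) (falling[-½]*[-4]^j≡centralC*j! j) ⟩
  ℤ→ℚ (+ centralC j * + (j !)) ℚ.* u        ≡⟨ cong (ℚ._* u) (ℤ→ℚ-homo-* (+ centralC j) (+ (j !))) ⟩
  ℤ→ℚ (+ centralC j) ℚ.* ℕ→ℚ (j !) ℚ.* u    ≡⟨ regroup′ (ℤ→ℚ (+ centralC j)) (ℕ→ℚ (j !)) u ⟩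
  ℤ→ℚ (+ centralC j) ℚ.* (u ℚ.* ℕ→ℚ (j !))  ≡⟨ cong (ℤ→ℚ (+ centralC j) ℚ.*_) (1/n*n≡1 (j !)) ⟩
  ℤ→ℚ (+ centralC j) ℚ.* 1ℚ                 ≡⟨ ℚ.*-identityʳ (ℤ→ℚ (+ centralC j)) ⟩
  ℤ→ℚ (+ centralC j)                        ∎
  where
  open ≡-Reasoning
  instance
    j!≢0 : ℕ.NonZero (j !)
    j!≢0 = j ℕ.!≢0
  u : ℚ
  u = + 1 / (j !)
  Q : ℤ
  Q = (- + 4) ℤ.^ j
  regroup : ∀ f u q → f ℚ.* u ℚ.* q ≡ f ℚ.* q ℚ.* u
  regroup = solve 3 (λ f u q → f :* u :* q := f :* q :* u) refl
  regroup′ : ∀ c f u → c ℚ.* f ℚ.* u ≡ c ℚ.* (u ℚ.* f)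
  regroup′ = solve 3 (λ c f u → c :* f :* u := c :* (u :* f)) refl

J̃₂-term*16^N≡weight*nCj : ∀ {N j} n → j ≤ N →
  sign j ℚ.* (binomℚ -½ j ℚ.* binomℚ -½ j) ℚ.* ℕ→ℚ (n C j) ℚ.* ℕ→ℚ (16 ^ N) ≡ ℤ→ℚ (weight N j * + (n C j))
J̃₂-term*16^N≡weight*nCj {N} {j} n j≤N = begin
  sign j ℚ.* (b ℚ.* b) ℚ.* ℤ→ℚ K ℚ.* ℕ→ℚ (16 ^ N)                 ≡⟨ cong (sign j ℚ.* (b ℚ.* b) ℚ.* ℤ→ℚ K ℚ.*_) 16^N≡ ⟩
  sign j ℚ.* (b ℚ.* b) ℚ.* ℤ→ℚ K ℚ.* (ℤ→ℚ Q ℚ.* ℤ→ℚ Q ℚ.* ℤ→ℚ F)  ≡⟨ regroup (sign j) b (ℤ→ℚ K) (ℤ→ℚ Q) (ℤ→ℚ F) ⟩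
  sign j ℚ.* (b ℚ.* ℤ→ℚ Q) ℚ.* (b ℚ.* ℤ→ℚ Q) ℚ.* ℤ→ℚ K ℚ.* ℤ→ℚ F  ≡⟨ cong₂ (λ s y → s ℚ.* y ℚ.* y ℚ.* ℤ→ℚ K ℚ.* ℤ→ℚ F) (sign≡[-1]^j j) (binom[-½]*[-4]^j≡centralC j) ⟩
  ℤ→ℚ s ℚ.* ℤ→ℚ c ℚ.* ℤ→ℚ c ℚ.* ℤ→ℚ K ℚ.* ℤ→ℚ F                   ≡⟨ push-ℤ→ℚ ⟨
  ℤ→ℚ (s * c * c * K * F)                                         ≡⟨ cong ℤ→ℚ (regroupℤ s c K F) ⟩
  ℤ→ℚ (weight N j * K)                                            ∎
  where
  open ≡-Reasoning
  b : ℚ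
  b = binomℚ -½ j
  s c K Q F : ℤ
  s = -1ℤ ℤ.^ j
  c = + centralC j
  K = + (n C j)
  Q = (- + 4) ℤ.^ j
  F = (+ 16) ℤ.^ (N ∸ j)
  16^N≡ : ℕ→ℚ (16 ^ N) ≡ ℤ→ℚ Q ℚ.* ℤ→ℚ Q ℚ.* ℤ→ℚ F
  16^N≡ = begin
    ℤ→ℚ (+ (16 ^ N))           ≡⟨ cong ℤ→ℚ (trans (pos-^ 16 N) (sym ([-4]^j*[-4]^j*16^[n∸j]≡16^n j≤N))) ⟩
    ℤ→ℚ (Q * Q * F)            ≡⟨ trans (ℤ→ℚ-homo-* (Q * Q) F) (cong (ℚ._* ℤ→ℚ F) (ℤ→ℚ-homo-* Q Q)) ⟩
    ℤ→ℚ Q ℚ.* ℤ→ℚ Q ℚ.* ℤ→ℚ F  ∎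
  push-ℤ→ℚ : ℤ→ℚ (s * c * c * K * F) ≡ ℤ→ℚ s ℚ.* ℤ→ℚ c ℚ.* ℤ→ℚ c ℚ.* ℤ→ℚ K ℚ.* ℤ→ℚ F
  push-ℤ→ℚ = trans (ℤ→ℚ-homo-* (s * c * c * K) F) (cong (ℚ._* ℤ→ℚ F)
           (trans (ℤ→ℚ-homo-* (s * c * c) K) (cong (ℚ._* ℤ→ℚ K)
             (trans (ℤ→ℚ-homo-* (s * c) c) (cong (ℚ._* ℤ→ℚ c) (ℤ→ℚ-homo-* s c))))))
  regroup : ∀ s b k q F → s ℚ.* (b ℚ.* b) ℚ.* k ℚ.* (q ℚ.* q ℚ.* F) ≡ s ℚ.* (b ℚ.* q) ℚ.* (b ℚ.* q) ℚ.* k ℚ.* F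
  regroup = solve 5 (λ s b k q F → s :* (b :* b) :* k :* (q :* q :* F) := s :* (b :* q) :* (b :* q) :* k :* F) refl
  regroupℤ : ∀ s c k F → s * c * c * k * F ≡ s * (c * c) * F * k
  regroupℤ = ℤ-Solver.solve-∀

sumTo-cong : ∀ n {f g : ℕ → ℚ} → (∀ j → j ≤ n → f j ≡ g j) → sumTo n f ≡ sumTo n g
sumTo-cong zero    f≡g = f≡g 0 z≤n
sumTo-cong (suc n) f≡g = cong₂ ℚ._+_ (sumTo-cong n (λ j j≤n → f≡g j (ℕ.m≤n⇒m≤1+n j≤n))) (f≡g (suc n) ℕ.≤-refl)

sumTo-distribʳ-* : ∀ n (f : ℕ → ℚ) c → sumTo n f ℚ.* c ≡ sumTo n (λ j → f j ℚ.* c)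
sumTo-distribʳ-* zero    f c = refl
sumTo-distribʳ-* (suc n) f c =
  trans (ℚ.*-distribʳ-+ c (sumTo n f) (f (suc n))) (cong (ℚ._+ f (suc n) ℚ.* c) (sumTo-distribʳ-* n f c))

sumTo-ℤ→ℚ : ∀ n (f : ℕ → ℤ) → sumTo n (λ j → ℤ→ℚ (f j)) ≡ ℤ→ℚ (sum≤ n f)
sumTo-ℤ→ℚ zero    f = refl
sumTo-ℤ→ℚ (suc n) f = trans (cong (ℚ._+ ℤ→ℚ (f (suc n))) (sumTo-ℤ→ℚ n f)) (sym (ℤ→ℚ-homo-+ (sum≤ n f) (f (suc n))))

J̃₂*16^N≡sum[weight*nCj] : ∀ {N} n → n ≤ N → J̃₂ n ℚ.* ℕ→ℚ (16 ^ N) ≡ ℤ→ℚ (sum≤ n (λ j → weight N j * + (n C j)))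
J̃₂*16^N≡sum[weight*nCj] n n≤N = trans (sumTo-distribʳ-* n _ _)
  (trans (sumTo-cong n (λ j j≤n → J̃₂-term*16^N≡weight*nCj n (ℕ.≤-trans j≤n n≤N))) (sumTo-ℤ→ℚ n _))

sumJ̃₂*16^N≡scaledSumJ̃₂ : ∀ N → sumTo N J̃₂ ℚ.* ℕ→ℚ (16 ^ N) ≡ ℤ→ℚ (scaledSumJ̃₂ N)
sumJ̃₂*16^N≡scaledSumJ̃₂ N =
  trans (sumTo-distribʳ-* N J̃₂ _) (trans (sumTo-cong N J̃₂*16^N≡sum[weight*nCj]) (sumTo-ℤ→ℚ N _))

parity : ∀ n → ∃ λ k → n ≡ k ℕ.+ k ⊎ n ≡ suc (k ℕ.+ k)
parity zero    = 0 , inj₁ refl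
parity (suc n) with parity n
... | k , inj₁ n≡2k   = k , inj₂ (cong suc n≡2k)
... | k , inj₂ n≡2k+1 = suc k , inj₁ (trans (cong suc n≡2k+1) (cong suc (sym (ℕ.+-suc k k))))

odd-prime : ∀ {p} → Prime p → p ≢ 2 → ∃ λ m-1 → p ≡ suc (suc m-1 ℕ.+ suc m-1)
odd-prime {p} p-prime p≢2 with parity p
... | k , inj₁ p≡k+k
  with prime⇒irreducible p-prime (ℕ.divides k (trans p≡k+k (sym (trans (ℕ.*-suc k 1) (cong (k ℕ.+_) (ℕ.*-identityʳ k))))))
...   | inj₁ ()
...   | inj₂ 2≡p = contradiction (sym 2≡p) p≢2
odd-prime p-prime p≢2 | zero , inj₂ p≡1 = contradiction (subst Prime p≡1 p-prime) ¬prime[1]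
odd-prime p-prime p≢2 | suc m-1 , inj₂ p≡2m+1 = m-1 , p≡2m+1

prime∤m⇒prime∤m^n : ∀ {p m} → Prime p → ¬ p ℕ.∣ m → ∀ n → ¬ p ℕ.∣ m ^ n
prime∤m⇒prime∤m^n p-prime p∤m zero    p∣1 = ¬prime[1] (subst Prime (ℕ.∣1⇒≡1 p∣1) p-prime)
prime∤m⇒prime∤m^n p-prime p∤m (suc n) p∣m*mⁿ with euclidsLemma _ _ p-prime p∣m*mⁿ
... | inj₁ p∣m  = p∤m p∣m
... | inj₂ p∣mⁿ = prime∤m⇒prime∤m^n p-prime p∤m n p∣mⁿ

odd-prime∤16^n : ∀ {p} → Prime p → p ≢ 2 → ∀ n → ¬ p ℕ.∣ 16 ^ n
odd-prime∤16^n p-prime p≢2 n p∣16ⁿ =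
  prime∤m⇒prime∤m^n p-prime p∤2 (4 ℕ.* n) (subst (_ ℕ.∣_) (ℕ.^-*-assoc 2 4 n) p∣16ⁿ)
  where
  p∤2 : ¬ _ ℕ.∣ 2
  p∤2 p∣2 with irreducible[2] p∣2
  ... | inj₁ p≡1 = ¬prime[1] (subst Prime p≡1 p-prime)
  ... | inj₂ p≡2 = p≢2 p≡2

≡0mod-p²-from-scaling : ∀ {x p b T} → ¬ p ℕ.∣ b → + (p ℕ.* p) ∣ T → x ℚ.* ℕ→ℚ b ≡ ℤ→ℚ T → ≡0mod[ x in-ℤ₍ p ^ 2 ₎] p
≡0mod-p²-from-scaling {x} {p} {b} p∤b (divides q refl) x*b≡q*p² = q , b , p∤b , (begin
  x ℚ.* ℕ→ℚ b              ≡⟨ x*b≡q*p² ⟩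
  ℤ→ℚ (q * + (p ℕ.* p))    ≡⟨ ℤ→ℚ-homo-* q (+ (p ℕ.* p)) ⟩
  ℤ→ℚ q ℚ.* ℕ→ℚ (p ℕ.* p)  ≡⟨ ℚ.*-comm (ℤ→ℚ q) (ℕ→ℚ (p ℕ.* p)) ⟩
  ℕ→ℚ (p ℕ.* p) ℚ.* ℤ→ℚ q  ≡⟨ cong (λ k → ℕ→ℚ (p ℕ.* k) ℚ.* ℤ→ℚ q) (ℕ.*-identityʳ p) ⟨
  ℕ→ℚ (p ^ 2) ℚ.* (q / 1)  ∎)
  where open ≡-Reasoning

mainTheorem9 : (p : ℕ) → Prime p → p ≢ 2 →
    ≡0mod[ sumTo (p ∸ 1) J̃₂ in-ℤ₍ p ^ 2 ₎] p
mainTheorem9 p p-prime p≢2 with odd-prime p-prime p≢2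
... | m-1 , refl = ≡0mod-p²-from-scaling {x = sumTo N J̃₂}
  (odd-prime∤16^n p-prime p≢2 N) (p²∣scaledSumJ̃₂ m-1 p-prime) (sumJ̃₂*16^N≡scaledSumJ̃₂ N)
  where
  N : ℕ
  N = suc m-1 ℕ.+ suc m-1
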